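{- Let $G$ be a finite abelian group, $\mathcal{E}\subset G$ a subgroup of index $2$, $\mathcal{O}=G\setminus\mathcal{E}$ and $W=\{a+a:a\in\mathcal{O}\}$. Let $x,y\in\mathcal{E}$ with $x\notin\{y,-y\}$. If $E(\mathcal{G}_x)\cap E(\mathcal{G}_y)\neq\emptyset$, then $x+y\in W$.
   Context: For $x\in\mathcal{E}$, $\mathcal{G}_x$ is the graph with vertex set $\mathcal{O}$ and edge set $E(\mathcal{G}_x)=\{\{a,b\}:a\neq b\in\mathcal{O},\ a+b=x\text{ or }a-b=x\}$. -}

module Defs where

open import Level using (Level; _⊔_)
open import Data.Nat using (ℕ)
open import Data.Fin using (Fin)
open import Data.Product using (Σ; ∃; _×_; _,_)
open import Data.Sum using (_⊎_)
open import Relation.Nullary using (¬_)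
open import Algebra.Bundles using (AbelianGroup)

module _ {c ℓ : Level} (G : AbelianGroup c ℓ) where
  open AbelianGroup G renaming (_∙_ to _+_; _⁻¹ to -_; ε to 0#)

  IsFinite : Set (c ⊔ ℓ)
  IsFinite = Σ ℕ λ n → Σ (Fin n → Carrier) λ f → ∀ g → ∃ λ i → f i ≈ g

  record IsSubgroup {p} (E : Carrier → Set p) : Set (c ⊔ ℓ ⊔ p) where
    field
      resp  : ∀ {a b} → a ≈ b → E a → E b
      has-0 : E 0#
      +-closed : ∀ {a b} → E a → E b → E (a + b)
      neg-closed : ∀ {a} → E a → E (- a)

  -- index 2: exactly two cosets, E and g + E for some g ∉ E
  HasIndexTwo : ∀ {p} (E : Carrier → Set p) → Set (c ⊔ p)
  HasIndexTwo E = Σ Carrier λ g → ¬ E g × (∀ h → E h ⊎ E (h - g))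

  Odd : ∀ {p} (E : Carrier → Set p) → Carrier → Set p
  Odd E a = ¬ E a

  InW : ∀ {p} (E : Carrier → Set p) → Carrier → Set (c ⊔ ℓ ⊔ p)
  InW E w = ∃ λ a → Odd E a × (a + a ≈ w)

  -- {a , b} ∈ E(𝒢_x) : a ≠ b ∈ 𝒪 and (a + b = x or a - b = x)
  -- (unordered edge: the condition is taken on either orientation)
  IsEdge : ∀ {p} (E : Carrier → Set p) → Carrier → Carrier → Carrier → Set (ℓ ⊔ p)
  IsEdge E x a b = Odd E a × Odd E b × ¬ (a ≈ b)
                   × ((a + b ≈ x) ⊎ (a - b ≈ x) ⊎ (b - a ≈ x))

module Submission where

-- An unordered pair {a , b} is an edge of 𝒢_x exactly when x is one of
-- its three "labels" a + b, a - b, b - a.  In any abelian group these labels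
-- satisfy
--     (a + b) + (a - b) = a + a,     (a + b) + (b - a) = b + b,
--     a - b = -(b - a).
-- Hence if x and y both label the same pair, then either they carry the same
-- label (so x = y), or they are the two opposite differences (so x = -y), or
-- one is the sum and the other a difference (so x + y = a + a or b + b).
-- Under the hypotheses x ≠ y and x ≠ -y only the last case survives, and since
-- the endpoints a, b of an edge lie in 𝒪, x + y ∈ W.

open import Defs
open import Level using (Level)
open import Data.Product using (∃; _×_; _,_)
open import Data.Sum using (_⊎_; inj₁; inj₂)
open import Data.Empty using (⊥-elim)
open import Relation.Nullary using (¬_)
open import Algebra.Bundles using (AbelianGroup)
import Algebra.Properties.Group as GroupProperties
import Algebra.Properties.CommutativeSemigroup as CommutativeSemigroupProperties
import Relation.Binary.Reasoning.Setoid as SetoidReasoning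

module Labels {c ℓ : Level} (G : AbelianGroup c ℓ) where
  open AbelianGroup G
  open GroupProperties group using (⁻¹-anti-homo-//)
  open CommutativeSemigroupProperties commutativeSemigroup using (interchange)
  open SetoidReasoning setoid

  Label : Carrier → Carrier → Carrier → Set ℓ
  Label a b x = (a ∙ b ≈ x) ⊎ (a - b ≈ x) ⊎ (b - a ≈ x)

  sum+difference : ∀ a b → (a ∙ b) ∙ (a - b) ≈ a ∙ a
  sum+difference a b = begin
    (a ∙ b) ∙ (a ∙ b ⁻¹) ≈⟨ interchange a b a (b ⁻¹) ⟩
    (a ∙ a) ∙ (b ∙ b ⁻¹) ≈⟨ ∙-congˡ (inverseʳ b) ⟩
    (a ∙ a) ∙ ε          ≈⟨ identityʳ (a ∙ a) ⟩
    a ∙ a                ∎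

  sum+difference′ : ∀ a b → (a ∙ b) ∙ (b - a) ≈ b ∙ b
  sum+difference′ a b = trans (∙-congʳ (comm a b)) (sum+difference b a)

  opposite-differences : ∀ a b → a - b ≈ (b - a) ⁻¹
  opposite-differences a b = sym (⁻¹-anti-homo-// b a)

  SquareOfEndpoint : Carrier → Carrier → Carrier → Set ℓ
  SquareOfEndpoint a b s = (a ∙ a ≈ s) ⊎ (b ∙ b ≈ s)

  sum-via-labels : ∀ {s t r x y} → s ≈ x → t ≈ y → s ∙ t ≈ r → r ≈ x ∙ y
  sum-via-labels p q e = sym (trans (∙-cong (sym p) (sym q)) e)

  labels-add-to-square : ∀ {a b x y} → Label a b x → Label a b y →
    ¬ x ≈ y → ¬ x ≈ y ⁻¹ → SquareOfEndpoint a b (x ∙ y)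
  labels-add-to-square {a} {b} (inj₁ p) (inj₂ (inj₁ q)) _ _ =
    inj₁ (sum-via-labels p q (sum+difference a b))
  labels-add-to-square {a} {b} (inj₁ p) (inj₂ (inj₂ q)) _ _ =
    inj₂ (sum-via-labels p q (sum+difference′ a b))
  labels-add-to-square {a} {b} (inj₂ (inj₁ p)) (inj₁ q) _ _ =
    inj₁ (sum-via-labels p q (trans (comm _ _) (sum+difference a b)))
  labels-add-to-square {a} {b} (inj₂ (inj₂ p)) (inj₁ q) _ _ =
    inj₂ (sum-via-labels p q (trans (comm _ _) (sum+difference′ a b)))
  labels-add-to-square (inj₁ p) (inj₁ q) x≉y _ = ⊥-elim (x≉y (trans (sym p) q))
  labels-add-to-square (inj₂ (inj₁ p)) (inj₂ (inj₁ q)) x≉y _ =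
    ⊥-elim (x≉y (trans (sym p) q))
  labels-add-to-square (inj₂ (inj₂ p)) (inj₂ (inj₂ q)) x≉y _ =
    ⊥-elim (x≉y (trans (sym p) q))
  labels-add-to-square {a} {b} (inj₂ (inj₁ p)) (inj₂ (inj₂ q)) _ x≉-y =
    ⊥-elim (x≉-y (trans (sym p) (trans (opposite-differences a b) (⁻¹-cong q))))
  labels-add-to-square {a} {b} (inj₂ (inj₂ p)) (inj₂ (inj₁ q)) _ x≉-y =
    ⊥-elim (x≉-y (trans (sym p) (trans (opposite-differences b a) (⁻¹-cong q))))

mainTheorem11 : ∀ {c ℓ p : Level} (G : AbelianGroup c ℓ) →
    IsFinite G →
    (E : AbelianGroup.Carrier G → Set p) → IsSubgroup G E → HasIndexTwo G E →
    (x y : AbelianGroup.Carrier G) → E x → E y →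
    ¬ (AbelianGroup._≈_ G x y) → ¬ (AbelianGroup._≈_ G x (AbelianGroup._⁻¹ G y)) →
    (∃ λ a → ∃ λ b → IsEdge G E x a b × IsEdge G E y a b) →
    InW G E (AbelianGroup._∙_ G x y)
mainTheorem11 G _ E _ _ x y _ _ x≉y x≉-y
  (a , b , (a-odd , b-odd , _ , x-label) , (_ , _ , _ , y-label))
  with Labels.labels-add-to-square G x-label y-label x≉y x≉-y
... | inj₁ aa≈xy = a , a-odd , aa≈xy
... | inj₂ bb≈xy = b , b-odd , bb≈xy
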